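{- For every set $\Gamma$ of $\mathcal{L}$-sentences and all $\mathcal{L}$-sentences $\phi,\psi$: if $\Gamma\cup\{\phi\}\models\psi$ then $\Gamma\models\phi\rightarrow\psi$.
   Context: Let $\mathcal{L}$ be a first-order language (constant, function and relation symbols) whose formulas are built from atomic formulas $R^n(t_1,\dots,t_n)$, $\top$ and $\bot$ using exactly the primitive operators $\wedge,\vee,\rightarrow,\forall,\exists$. An $\mathcal{L}$-model is a tuple $\mathfrak{M}=\langle W,\prec,M,|\cdot|\rangle$ where $W$ is a nonempty set of worlds, $\prec$ is a transitive (not necessarily reflexive) binary relation on $W$, $M$ is a nonempty set (the single domain shared by all worlds), $|c|\in M$ for each constant symbol, $|f^n|:M^n\to M$ for each function symbol, and $|R^n|:W\to\mathcal{P}(M^n)$ for each relation symbol, subject to: $w\prec u$ implies $|R^n|(w)\subseteq|R^n|(u)$. Terms are evaluated in $M$ as usual. Forcing: $w\Vdash\top$; $w\not\Vdash\bot$; $w\Vdash R^n(t_1,\dots,t_n)(\bar a)$ iff $\langle|t_1|(\bar a),\dots,|t_n|(\bar a)\rangle\in|R^n|(w)$; $\wedge,\vee$ are evaluated pointwise at $w$; $w\Vdash(\phi\rightarrow\psi)(\bar a)$ iff for all $u$ with $w\prec u$, $u\Vdash\phi(\bar a)$ implies $u\Vdash\psi(\bar a)$; $w\Vdash\exists v\phi(\bar a)$ iff $w\Vdash\phi(\bar a,b)$ for some $b\in M$; $w\Vdash\forall v\phi(\bar a)$ iff $w\Vdash\phi(\bar a,b)$ for all $b\in M$. For sentences, $\Gamma\models\phi$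 means: for every $\mathcal{L}$-model and every world $w$, if $w$ forces every member of $\Gamma$ then $w\Vdash\phi$. -}

module Defs where

open import Data.Nat using (ℕ; zero; suc)
open import Data.Fin using (Fin; zero; suc)
open import Data.Vec using (Vec; []; _∷_)
open import Data.Product using (_×_; Σ)
open import Data.Sum using (_⊎_)
open import Data.Unit using (⊤)
open import Data.Empty using (⊥)
open import Relation.Binary.PropositionalEquality using (_≡_)

record Language : Set₁ where
  field
    Const : Set
    Func  : ℕ → Set
    Rel   : ℕ → Set

module _ (L : Language) where
  open Language L

  -- Terms with at most n free variables (de Bruijn indices, Fin n).
  data Term (n : ℕ) : Set where
    var   : Fin n → Term n
    const : Const → Term n
    app   : {k : ℕ} → Func k → Vec (Term n) k → Term n

  data Formula (n : ℕ) : Set where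
    atom  : {k : ℕ} → Rel k → Vec (Term n) k → Formula n
    ⊤'    : Formula n
    ⊥'    : Formula n
    _∧'_  : Formula n → Formula n → Formula n
    _∨'_  : Formula n → Formula n → Formula n
    _⇒'_  : Formula n → Formula n → Formula n
    ∀'    : Formula (suc n) → Formula n
    ∃'    : Formula (suc n) → Formula n

  Sentence : Set
  Sentence = Formula zero

  -- Kripke models with constant (shared) domain and transitive accessibility.
  record Model : Set₁ where
    field
      W      : Set
      w₀     : W
      _≺_    : W → W → Set
      ≺-trans : ∀ {w u v} → w ≺ u → u ≺ v → w ≺ v
      M      : Set
      m₀     : M
      constI : Const → M
      funcI  : {k : ℕ} → Func k → Vec M k → M
      relI   : {k : ℕ} → Rel k → W → Vec M k → Set
      relI-mono : ∀ {k} (R : Rel k) {w u} (xs : Vec M k) →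
                  w ≺ u → relI R w xs → relI R u xs

  module _ (𝔐 : Model) where
    open Model 𝔐

    mutual
      evalT : {n : ℕ} → (Fin n → M) → Term n → M
      evalT ρ (var i)    = ρ i
      evalT ρ (const c)  = constI c
      evalT ρ (app f ts) = funcI f (evalTs ρ ts)

      evalTs : {n k : ℕ} → (Fin n → M) → Vec (Term n) k → Vec M k
      evalTs ρ []       = []
      evalTs ρ (t ∷ ts) = evalT ρ t ∷ evalTs ρ ts

    extend : {n : ℕ} → (Fin n → M) → M → Fin (suc n) → M
    extend ρ b zero    = b
    extend ρ b (suc i) = ρ i

    forces : {n : ℕ} → W → (Fin n → M) → Formula n → Set
    forces w ρ (atom R ts) = relI R w (evalTs ρ ts)
    forces w ρ ⊤'          = ⊤
    forces w ρ ⊥'          = ⊥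
    forces w ρ (φ ∧' ψ)    = forces w ρ φ × forces w ρ ψ
    forces w ρ (φ ∨' ψ)    = forces w ρ φ ⊎ forces w ρ ψ
    forces w ρ (φ ⇒' ψ)    = ∀ u → w ≺ u → forces u ρ φ → forces u ρ ψ
    forces w ρ (∀' φ)      = ∀ (b : M) → forces w (extend ρ b) φ
    forces w ρ (∃' φ)      = Σ M (λ b → forces w (extend ρ b) φ)

    emptyEnv : Fin zero → M
    emptyEnv ()

    forcesS : W → Sentence → Set
    forcesS w φ = forces w emptyEnv φ

  SentenceSet : Set₁
  SentenceSet = Sentence → Set

  _∪｛_｝ : SentenceSet → Sentence → SentenceSet
  (Γ ∪｛ φ ｝) χ = Γ χ ⊎ χ ≡ φ

  _⊨_ : SentenceSet → Sentence → Set₁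
  Γ ⊨ φ = (𝔐 : Model) (w : Model.W 𝔐) →
          (∀ γ → Γ γ → forcesS 𝔐 w γ) → forcesS 𝔐 w φ

-- Suppose Γ ∪ {φ} ⊨ ψ, and let w force every sentence of Γ. To see that
-- w ⊩ φ → ψ, take a successor u of w forcing φ. Forcing is persistent
-- (upward closed along ≺): this holds for atoms by monotonicity of the
-- relation interpretations, and for implications by transitivity of ≺, the
-- remaining connectives and quantifiers following by induction (the domain is
-- shared by all worlds, so the quantifier cases need no transport of
-- witnesses). Hence u still forces Γ, and since it forces φ it forces all of
-- Γ ∪ {φ}; the hypothesis then gives u ⊩ ψ.
module Submission where

open import Defs
open import Data.Nat using (ℕ)
open import Data.Fin using (Fin)
open import Data.Product using (_,_)
open import Data.Sum using (inj₁; inj₂)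
open import Relation.Binary.PropositionalEquality using (refl)

module _ (L : Language) (𝔐 : Model L) where
  open Model 𝔐

  forces-persistent : {n : ℕ} (χ : Formula L n) (ρ : Fin n → M) {w u : W} →
                      w ≺ u → forces L 𝔐 w ρ χ → forces L 𝔐 u ρ χ
  forces-persistent (atom R ts) ρ w≺u wχ        = relI-mono R _ w≺u wχ
  forces-persistent ⊤'          ρ w≺u wχ        = wχ
  forces-persistent ⊥'          ρ w≺u ()
  forces-persistent (α ∧' β)    ρ w≺u (wα , wβ) =
    forces-persistent α ρ w≺u wα , forces-persistent β ρ w≺u wβ
  forces-persistent (α ∨' β)    ρ w≺u (inj₁ wα) = inj₁ (forces-persistent α ρ w≺u wα)
  forces-persistent (α ∨' β)    ρ w≺u (inj₂ wβ) = inj₂ (forces-persistent β ρ w≺u wβ)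
  forces-persistent (α ⇒' β)    ρ w≺u wχ        = λ v u≺v → wχ v (≺-trans w≺u u≺v)
  forces-persistent (∀' α)      ρ w≺u wχ        =
    λ b → forces-persistent α (extend L 𝔐 ρ b) w≺u (wχ b)
  forces-persistent (∃' α)      ρ w≺u (b , wα)  =
    b , forces-persistent α (extend L 𝔐 ρ b) w≺u wα

  forcesSet-persistent : (Γ : SentenceSet L) {w u : W} → w ≺ u →
                         (∀ γ → Γ γ → forcesS L 𝔐 w γ) →
                         (∀ γ → Γ γ → forcesS L 𝔐 u γ)
  forcesSet-persistent Γ w≺u wΓ γ γ∈Γ = forces-persistent γ _ w≺u (wΓ γ γ∈Γ)

  forces-∪｛｝ : (Γ : SentenceSet L) (φ : Sentence L) {u : W} →
                (∀ γ → Γ γ → forcesS L 𝔐 u γ) → forcesS L 𝔐 u φ →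
                (∀ γ → _∪｛_｝ L Γ φ γ → forcesS L 𝔐 u γ)
  forces-∪｛｝ Γ φ uΓ uφ γ (inj₁ γ∈Γ) = uΓ γ γ∈Γ
  forces-∪｛｝ Γ φ uΓ uφ γ (inj₂ refl) = uφ

mainTheorem5 : (L : Language) (Γ : SentenceSet L) (φ ψ : Sentence L) →
    _⊨_ L (_∪｛_｝ L Γ φ) ψ → _⊨_ L Γ (_⇒'_ φ ψ)
mainTheorem5 L Γ φ ψ Γφ⊨ψ 𝔐 w wΓ u w≺u uφ =
  Γφ⊨ψ 𝔐 u (forces-∪｛｝ L 𝔐 Γ φ (forcesSet-persistent L 𝔐 Γ w≺u wΓ) uφ)
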